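{- For any $t\colon \mathbb{N}_+ \to \mathbb{N}_+$, the class $\mathrm{DACA}(t)$ is closed under complement (with respect to $\Sigma^+$).
   Context: A cellular automaton (CA) is $C=(Q,\delta,\Sigma)$ with finite state set $Q$, local rule $\delta\colon Q^3\to Q$, input alphabet $\Sigma\subseteq Q$, and an inactive state $q\in Q\setminus\Sigma$ with $\delta(z_1,z_2,z_3)=q$ iff $z_2=q$; the global map is $\Delta(c)(z)=\delta(c(z-1),c(z),c(z+1))$ on $Q^{\mathbb{Z}}$. For input $w\in\Sigma^+$ the initial configuration $c_0$ has $c_0(i)=w(i)$ for $0\le i<|w|$ and $q$ elsewhere. For $F\subseteq Q\setminus\{q\}$, a configuration $\Delta^\tau(c_0)$ is $F$-final if all its cells are in $F\cup\{q\}$. A decider ACA (DACA) is a CA with nonempty disjoint sets $A,R\subseteq Q\setminus\{q\}$ of accept and reject states such that every input $w\in\Sigma^+$ leads to an $A$-final or an $R$-final configuration; $C$ accepts $w$ if it reaches an $A$-final configuration with no earlier $R$-final configuration, and rejects $w$ if it reaches an $R$-final configuration with no earlier $A$-final one. The time taken on $w$ is the number of steps until the first $A$- or $R$-final configuration. $L(C)$ is the set of accepted words. $\mathrm{DACA}(t)$ is the class of $L(C)$ for DACAs deciding every input $w$ within $t(|w|)$ steps. -}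

module Defs where

open import Data.Nat using (ℕ; zero; suc; _≤_; _<_)
open import Data.Integer using (ℤ; +_; -[1+_]; _+_; _-_; 1ℤ)
open import Data.Fin using (Fin)
open import Data.List using (List; []; _∷_)
open import Data.List.NonEmpty using (List⁺; toList; length)
open import Data.Maybe using (Maybe; just; nothing)
open import Data.Product using (Σ; _×_; _,_; ∃)
open import Data.Sum using (_⊎_)
open import Data.Empty using (⊥)
open import Relation.Nullary using (¬_)
open import Relation.Unary using (Pred)
open import Data.Fin.Subset using (Subset; _∈_; _∉_)
open import Relation.Binary.PropositionalEquality using (_≡_; _≢_)
open import Function.Definitions using (Injective)
open import Function.Bundles using (_⇔_)
open import Level using (0ℓ)

Word⁺ : ℕ → Set
Word⁺ m = List⁺ (Fin m)

Language : ℕ → Set₁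
Language m = Pred (Word⁺ m) 0ℓ

nth : {A : Set} → List A → ℕ → Maybe A
nth []       _       = nothing
nth (x ∷ xs) zero    = just x
nth (x ∷ xs) (suc n) = nth xs n

-- A decider ACA with input alphabet Σ = Fin m.  The state set is Q = Fin nQ
-- (finite); Σ ⊆ Q is given by an injective embedding ι : Fin m → Q.
record DACA (m : ℕ) : Set₁ where
  field
    nQ       : ℕ
    δ        : Fin nQ → Fin nQ → Fin nQ → Fin nQ
    ι        : Fin m → Fin nQ
    ι-inj    : Injective _≡_ _≡_ ι
    q        : Fin nQ
    q∉Σ      : ∀ a → ι a ≢ q
    δ-q      : ∀ z₁ z₂ z₃ → (δ z₁ z₂ z₃ ≡ q) ⇔ (z₂ ≡ q)
    Acc      : Subset nQ
    Rej      : Subset nQ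
    Acc≠∅    : ∃ λ s → s ∈ Acc
    Rej≠∅    : ∃ λ s → s ∈ Rej
    q∉Acc    : q ∉ Acc
    q∉Rej    : q ∉ Rej
    disjoint : ∀ s → s ∈ Acc → s ∈ Rej → ⊥

  Q : Set
  Q = Fin nQ

  Config : Set
  Config = ℤ → Q

  Δ : Config → Config
  Δ c z = δ (c (z - 1ℤ)) (c z) (c (z + 1ℤ))

  Δ^ : ℕ → Config → Config
  Δ^ zero    c = c
  Δ^ (suc τ) c = Δ (Δ^ τ c)

  init : Word⁺ m → Config
  init w (+ n) with nth (toList w) n
  ... | just a  = ι a
  ... | nothing = q
  init w -[1+ n ] = q

  Final : Subset nQ → Config → Set
  Final F c = ∀ z → c z ∈ F ⊎ c z ≡ q

  conf : Word⁺ m → ℕ → Config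
  conf w τ = Δ^ τ (init w)

  Accepts : Word⁺ m → Set
  Accepts w = Σ ℕ λ τ → Final Acc (conf w τ) × (∀ τ' → τ' < τ → ¬ Final Rej (conf w τ'))

  Rejects : Word⁺ m → Set
  Rejects w = Σ ℕ λ τ → Final Rej (conf w τ) × (∀ τ' → τ' < τ → ¬ Final Acc (conf w τ'))

  DecidesWithin : (ℕ → ℕ) → Set
  DecidesWithin t = ∀ w → Σ ℕ λ τ → τ ≤ t (length w) ×
                      (Final Acc (conf w τ) ⊎ Final Rej (conf w τ))

L[_] : ∀ {m} → DACA m → Language m
L[ C ] w = DACA.Accepts C w

InDACA : (m : ℕ) → (ℕ → ℕ) → Language m → Set₁
InDACA m t L = Σ (DACA m) λ C → DACA.DecidesWithin C t × (∀ w → L w ⇔ L[ C ] w)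

complement : ∀ {m} → Language m → Language m
complement L w = ¬ L w

-- Exchanging the accept and reject states of a DACA leaves its dynamics untouched, so
-- the swapped automaton reaches an accepting configuration exactly when the original
-- first reaches a rejecting one, within the same time bound.  Since the original decides
-- every input, rejecting is the same as not accepting: a configuration cannot be
-- accepting and rejecting at once (cell 0 never becomes quiescent), and finality is
-- decidable (only the |w| cells of the input can be active), so there is a first halting
-- time, at which the input is either accepted or rejected.
module Submission where

open import Defs
open import Data.Nat using (ℕ; zero; suc; _<_; z≤n; s≤s)
open import Data.Nat.Properties using (<-cmp)
open import Data.Integer using (+_; -[1+_]; _+_; _-_; 1ℤ)
open import Data.Fin using (Fin; toℕ; fromℕ<)
open import Data.Fin.Properties using (all?; _≟_; toℕ-fromℕ<)
open import Data.Fin.Subset using (_∈_)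
open import Data.Fin.Subset.Properties using (_∈?_)
open import Data.List using (List; _∷_; lookup)
import Data.List as List
open import Data.List.NonEmpty using (toList; length)
open import Data.Maybe using (just; nothing)
open import Data.Product using (∃; _×_; _,_)
open import Data.Sum using (_⊎_; inj₁; inj₂; [_,_])
import Data.Sum as Sum
open import Function using (id; _∘_)
open import Function.Bundles using (_⇔_; mk⇔; Equivalence)
open import Function.Construct.Composition using (_⇔-∘_)
open import Function.Construct.Symmetry using (⇔-sym)
open import Relation.Binary using (tri<; tri≈; tri>)
open import Relation.Binary.PropositionalEquality using (_≡_; _≢_; refl; cong; sym; subst)
open import Relation.Nullary using (¬_; Dec; yes; no)
open import Relation.Nullary.Decidable using (_⊎-dec_)
import Relation.Nullary.Decidable as Dec
open import Relation.Nullary.Negation using (contradiction)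
open import Function.Related.TypeIsomorphisms using (¬-cong-⇔)
open import Relation.Unary using (Pred; Decidable)

least-witness : ∀ {p} {P : Pred ℕ p} → Decidable P →
                ∀ n → P n → ∃ λ k → P k × (∀ j → j < k → ¬ P j)
least-witness P? zero    p = zero , p , λ _ ()
least-witness P? (suc n) p with P? zero
... | yes p₀ = zero , p₀ , λ _ ()
... | no ¬p₀ with least-witness (P? ∘ suc) n p
...   | k , pk , below = suc k , pk , λ where
          zero    _         → ¬p₀
          (suc j) (s≤s j<k) → below j j<k

nth-just⇒< : ∀ {A : Set} (xs : List A) n {a : A} → nth xs n ≡ just a → n < List.length xs
nth-just⇒< (x ∷ xs) zero    _ = s≤s z≤n
nth-just⇒< (x ∷ xs) (suc n) e = s≤s (nth-just⇒< xs n e)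

nth-lookup : ∀ {A : Set} (xs : List A) (i : Fin (List.length xs)) →
             nth xs (toℕ i) ≡ just (lookup xs i)
nth-lookup (x ∷ xs) Fin.zero    = refl
nth-lookup (x ∷ xs) (Fin.suc i) = nth-lookup xs i

module _ {m : ℕ} (C : DACA m) where
  open DACA C

  conf≡q⇔init≡q : ∀ w τ z → conf w τ z ≡ q ⇔ init w z ≡ q
  conf≡q⇔init≡q w zero    z = mk⇔ id id
  conf≡q⇔init≡q w (suc τ) z = conf≡q⇔init≡q w τ z ⇔-∘ δ-q _ _ _

  init-toℕ≢q : ∀ w (i : Fin (length w)) → init w (+ toℕ i) ≢ q
  init-toℕ≢q w i rewrite nth-lookup (toList w) i = q∉Σ _

  init≢q⇒index : ∀ w z → init w z ≢ q → ∃ λ (i : Fin (length w)) → z ≡ + toℕ i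
  init≢q⇒index w -[1+ n ] active = contradiction refl active
  init≢q⇒index w (+ n)    active with nth (toList w) n in eq
  ... | just a  = fromℕ< n<|w| , cong +_ (sym (toℕ-fromℕ< n<|w|))
    where n<|w| = nth-just⇒< (toList w) n eq
  ... | nothing = contradiction refl active

  Final⇔cellsIn : ∀ F w τ → Final F (conf w τ) ⇔ (∀ (i : Fin (length w)) → conf w τ (+ toℕ i) ∈ F)
  Final⇔cellsIn F w τ = mk⇔ cellsIn final
    where
    cellsIn : Final F (conf w τ) → ∀ i → conf w τ (+ toℕ i) ∈ F
    cellsIn fin i with fin (+ toℕ i)
    ... | inj₁ s∈F = s∈F
    ... | inj₂ s≡q = contradiction (Equivalence.to (conf≡q⇔init≡q w τ _) s≡q) (init-toℕ≢q w i)

    final : (∀ i → conf w τ (+ toℕ i) ∈ F) → Final F (conf w τ)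
    final h z with conf w τ z ≟ q
    ... | yes s≡q = inj₂ s≡q
    ... | no  s≢q with init≢q⇒index w z (s≢q ∘ Equivalence.from (conf≡q⇔init≡q w τ z))
    ...   | i , refl = inj₁ (h i)

  Final? : ∀ F w τ → Dec (Final F (conf w τ))
  Final? F w τ = Dec.map (⇔-sym (Final⇔cellsIn F w τ)) (all? λ i → conf w τ (+ toℕ i) ∈? F)

  conf-origin≢q : ∀ w τ → conf w τ (+ 0) ≢ q
  conf-origin≢q w τ = init-toℕ≢q w Fin.zero ∘ Equivalence.to (conf≡q⇔init≡q w τ (+ 0))

  Final-Acc⇒¬Final-Rej : ∀ w τ → Final Acc (conf w τ) → ¬ Final Rej (conf w τ)
  Final-Acc⇒¬Final-Rej w τ acc rej with acc (+ 0) | rej (+ 0)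
  ... | inj₁ s∈A | inj₁ s∈R = disjoint _ s∈A s∈R
  ... | inj₂ s≡q | _        = conf-origin≢q w τ s≡q
  ... | _        | inj₂ s≡q = conf-origin≢q w τ s≡q

  Halted : Word⁺ m → ℕ → Set
  Halted w τ = Final Acc (conf w τ) ⊎ Final Rej (conf w τ)

  Halted⇒accepts⊎rejects : ∀ w τ → Halted w τ → Accepts w ⊎ Rejects w
  Halted⇒accepts⊎rejects w τ halted
    with least-witness (λ τ → Final? Acc w τ ⊎-dec Final? Rej w τ) τ halted
  ... | τ₀ , inj₁ acc , before = inj₁ (τ₀ , acc , λ τ′ τ′<τ₀ → before τ′ τ′<τ₀ ∘ inj₂)
  ... | τ₀ , inj₂ rej , before = inj₂ (τ₀ , rej , λ τ′ τ′<τ₀ → before τ′ τ′<τ₀ ∘ inj₁)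

  accepts⇒¬rejects : ∀ w → Accepts w → ¬ Rejects w
  accepts⇒¬rejects w (τa , acc , noRejBefore) (τr , rej , noAccBefore) with <-cmp τa τr
  ... | tri< τa<τr _ _ = noAccBefore τa τa<τr acc
  ... | tri≈ _ refl _  = Final-Acc⇒¬Final-Rej w τa acc rej
  ... | tri> _ _ τr<τa = noRejBefore τr τr<τa rej

  rejects⇔¬accepts : ∀ {t} → DecidesWithin t → ∀ w → Rejects w ⇔ (¬ Accepts w)
  rejects⇔¬accepts decides w = mk⇔ (λ rej acc → accepts⇒¬rejects w acc rej) rejects
    where
    rejects : ¬ Accepts w → Rejects w
    rejects ¬acc with decides w
    ... | τ , _ , halted = [ (λ acc → contradiction acc ¬acc) , id ] (Halted⇒accepts⊎rejects w τ halted)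

swapVerdicts : ∀ {m} → DACA m → DACA m
swapVerdicts C = record
  { nQ = nQ ; δ = δ ; ι = ι ; ι-inj = ι-inj ; q = q ; q∉Σ = q∉Σ ; δ-q = δ-q
  ; Acc = Rej ; Rej = Acc ; Acc≠∅ = Rej≠∅ ; Rej≠∅ = Acc≠∅
  ; q∉Acc = q∉Rej ; q∉Rej = q∉Acc ; disjoint = λ s s∈R s∈A → disjoint s s∈A s∈R }
  where open DACA C

module _ {m : ℕ} (C : DACA m) where
  private
    module C  = DACA C
    module C′ = DACA (swapVerdicts C)

  init-swapVerdicts : ∀ w z → C′.init w z ≡ C.init w z
  init-swapVerdicts w -[1+ n ] = refl
  init-swapVerdicts w (+ n) with nth (toList w) n
  ... | just a  = refl
  ... | nothing = refl

  conf-swapVerdicts : ∀ w τ z → C′.conf w τ z ≡ C.conf w τ z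
  conf-swapVerdicts w zero    z = init-swapVerdicts w z
  conf-swapVerdicts w (suc τ) z
    rewrite conf-swapVerdicts w τ (z - 1ℤ) | conf-swapVerdicts w τ z | conf-swapVerdicts w τ (z + 1ℤ)
    = refl

  Final-swapVerdicts⁺ : ∀ {F} w τ → C.Final F (C.conf w τ) → C′.Final F (C′.conf w τ)
  Final-swapVerdicts⁺ {F} w τ fin z =
    subst (λ s → s ∈ F ⊎ s ≡ C.q) (sym (conf-swapVerdicts w τ z)) (fin z)

  Final-swapVerdicts⁻ : ∀ {F} w τ → C′.Final F (C′.conf w τ) → C.Final F (C.conf w τ)
  Final-swapVerdicts⁻ {F} w τ fin z =
    subst (λ s → s ∈ F ⊎ s ≡ C.q) (conf-swapVerdicts w τ z) (fin z)

  accepts-swapVerdicts⇔rejects : ∀ w → C′.Accepts w ⇔ C.Rejects w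
  accepts-swapVerdicts⇔rejects w = mk⇔
    (λ (τ , rej , noAcc) → τ , Final-swapVerdicts⁻ w τ rej , λ τ′ τ′<τ → noAcc τ′ τ′<τ ∘ Final-swapVerdicts⁺ w τ′)
    (λ (τ , rej , noAcc) → τ , Final-swapVerdicts⁺ w τ rej , λ τ′ τ′<τ → noAcc τ′ τ′<τ ∘ Final-swapVerdicts⁻ w τ′)

  decidesWithin-swapVerdicts : ∀ {t} → C.DecidesWithin t → C′.DecidesWithin t
  decidesWithin-swapVerdicts decides w with decides w
  ... | τ , τ≤t , halted = τ , τ≤t , Sum.swap (Sum.map (Final-swapVerdicts⁺ w τ) (Final-swapVerdicts⁺ w τ) halted)

proposition6 : (m : ℕ) (t : ℕ → ℕ) → (∀ n → 0 < t (suc n)) →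
    (L : Language m) → InDACA m t L → InDACA m t (complement L)
proposition6 m t _ L (C , decides , L⇔L[C]) =
  swapVerdicts C , decidesWithin-swapVerdicts C {t} decides , λ w →
    ⇔-sym (accepts-swapVerdicts⇔rejects C w)
      ⇔-∘ (⇔-sym (rejects⇔¬accepts C {t} decides w) ⇔-∘ ¬-cong-⇔ (L⇔L[C] w))
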